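{- There exist an integer $k\ge 2$, an integer $n\ge 1$, and an $\mathrm{SL}_k$-frieze pattern of height $n$ over $\mathbb{Q}$ which is not periodic and all of whose entries $c_{i,j}$ ($i\in\mathbb{Z}$, $1\le j\le n$) are positive integers.
   Context: Let $k\ge 2$ and $n\ge 1$ be integers and $K$ a field. An $\mathrm{SL}_k$-frieze pattern of height $n$ over $K$ is a family $(a_{i,j})$ of elements of $K$, indexed by $i\in\mathbb{Z}$ and $i-k\le j\le i+n+k-1$, such that $a_{i,j}=0$ for $i-k\le j\le i-2$ and for $i+n+1\le j\le i+n+k-1$, $a_{i,i-1}=a_{i,i+n}=1$, and (writing $c_{i,j}:=a_{i,i+j-1}$ for $1\le j\le n$, the "entries" of the pattern, which are otherwise arbitrary) for every $i\in\mathbb{Z}$ and every $j$ with $i-1\le j\le i+n$ the $k\times k$ matrix $(a_{r,s})_{i\le r\le i+k-1,\ j\le s\le j+k-1}$ has determinant $1$. The pattern is periodic if there is $m>0$ with $c_{i,j}=c_{i+m,j}$ for all $i\in\mathbb{Z}$, $1\le j\le n$. -}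

module Defs where

open import Data.Nat as ℕ using (ℕ; zero; suc)
open import Data.Integer as ℤ using (ℤ; +_)
open import Data.Rational as ℚ using (ℚ)
open import Data.Fin as Fin using (Fin; toℕ; punchIn)
open import Data.Product using (Σ; _×_)
open import Relation.Binary.PropositionalEquality using (_≡_)

altSum : (m : ℕ) → (Fin m → ℚ) → ℚ
altSum zero    f = ℚ.0ℚ
altSum (suc m) f = f Fin.zero ℚ.- altSum m (λ x → f (Fin.suc x))

det : (m : ℕ) → (Fin m → Fin m → ℚ) → ℚ
det zero    M = ℚ.1ℚ
det (suc m) M =
  altSum (suc m) (λ c → M Fin.zero c ℚ.* det m (λ r s → M (Fin.suc r) (punchIn c s)))

fz : {m : ℕ} → Fin m → ℤ
fz x = + toℕ x

-- An SL_k-frieze pattern of height n over ℚ, given as a function a : ℤ → ℤ → ℚ;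
-- only the values a i j with i - k ≤ j ≤ i + n + k - 1 are constrained/used.
IsSLFrieze : (k n : ℕ) → (ℤ → ℤ → ℚ) → Set
IsSLFrieze k n a =
  (∀ (i j : ℤ) → i ℤ.- + k ℤ.≤ j → j ℤ.≤ i ℤ.- + 2 → a i j ≡ ℚ.0ℚ) ×
  (∀ (i j : ℤ) → i ℤ.+ + n ℤ.+ + 1 ℤ.≤ j → j ℤ.≤ i ℤ.+ + n ℤ.+ + k ℤ.- + 1 → a i j ≡ ℚ.0ℚ) ×
  (∀ (i : ℤ) → a i (i ℤ.- + 1) ≡ ℚ.1ℚ) ×
  (∀ (i : ℤ) → a i (i ℤ.+ + n) ≡ ℚ.1ℚ) ×
  (∀ (i j : ℤ) → i ℤ.- + 1 ℤ.≤ j → j ℤ.≤ i ℤ.+ + n →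
     det k (λ r s → a (i ℤ.+ fz r) (j ℤ.+ fz s)) ≡ ℚ.1ℚ)

-- entries c i j = a i (i + j - 1), meaningful for 1 ≤ j ≤ n
entry : (ℤ → ℤ → ℚ) → ℤ → ℤ → ℚ
entry a i j = a i (i ℤ.+ j ℤ.- + 1)

IsPeriodic : (n : ℕ) → (ℤ → ℤ → ℚ) → Set
IsPeriodic n a = Σ ℕ λ m → 0 ℕ.< m ×
  (∀ (i j : ℤ) → + 1 ℤ.≤ j → j ℤ.≤ + n → entry a i j ≡ entry a (i ℤ.+ + m) j)

IsPosInt : ℚ → Set
IsPosInt q = Σ ℕ λ m → 0 ℕ.< m × q ≡ (+ m) ℚ./ 1

-- Take k = 4, n = 5 and let row i depend only on i mod 4, with entries
-- (1 1 1 1 1), (1 1 2 1 x), (1 2 2 1 1), (2 2 2 1 1).  The entry x = c_{i,5} of a row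
-- i ≡ 1 (mod 4) has zero cofactor in every 4 × 4 window containing it, so all window
-- determinants equal 1 however x is chosen, independently in each such row.  Taking
-- x = 2 in row 1 and x = 1 in every other row gives a positive integral SL_4-frieze
-- that is not periodic, since c_{1,5} = 2 but c_{i,5} = 1 for all i > 1.  The finitely
-- many window determinants (for x ∈ {1, 2}) are checked by evaluation.

module Submission where

open import Defs
open import Data.Nat as ℕ using (ℕ; zero; suc)
open import Data.Integer as ℤ using (ℤ; +_; -[1+_]; ∣_∣)
import Data.Nat.Properties as ℕ
import Data.Integer.Properties as ℤ
open import Data.Integer.Tactic.RingSolver using (solve-∀)
open import Data.Rational as ℚ using (ℚ)
open import Data.Fin as Fin using (Fin; zero; suc; toℕ)
open import Data.Fin.Patterns using (0F; 1F; 2F; 3F)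
open import Data.Fin.Properties using (all?; toℕ-fromℕ<)
open import Data.Vec using (Vec; _∷_; [])
open import Data.Bool using (Bool; true; false; if_then_else_)
open import Data.Product using (Σ; _×_; _,_)
open import Relation.Nullary using (¬_; Dec)
open import Relation.Nullary.Decidable using (from-yes; does; _→-dec_)
open import Relation.Binary.PropositionalEquality

i+c-i≡c : ∀ i c → (i ℤ.+ c) ℤ.- i ≡ c
i+c-i≡c = solve-∀

offset-≥ : ∀ i j c → i ℤ.+ c ℤ.≤ j → c ℤ.≤ j ℤ.- i
offset-≥ i j c h = subst (ℤ._≤ j ℤ.- i) (i+c-i≡c i c) (ℤ.+-monoˡ-≤ (ℤ.- i) h)

offset-≤ : ∀ i j c → j ℤ.≤ i ℤ.+ c → j ℤ.- i ℤ.≤ c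
offset-≤ i j c h = subst (j ℤ.- i ℤ.≤_) (i+c-i≡c i c) (ℤ.+-monoˡ-≤ (ℤ.- i) h)

∀-interval : ∀ {p} (P : ℤ → Set p) (m : ℤ) (n : ℕ) →
  (∀ (t : Fin (suc n)) → P (m ℤ.+ fz t)) → ∀ d → m ℤ.≤ d → d ℤ.≤ m ℤ.+ + n → P d
∀-interval P m n P-at d m≤d d≤m+n = subst P m+t≡d (P-at t)
  where
  +∣d-m∣≡d-m : + ∣ d ℤ.- m ∣ ≡ d ℤ.- m
  +∣d-m∣≡d-m = ℤ.0≤i⇒+∣i∣≡i (ℤ.i≤j⇒0≤j-i m≤d)
  ∣d-m∣≤n : ∣ d ℤ.- m ∣ ℕ.≤ n
  ∣d-m∣≤n = ℤ.drop‿+≤+ (subst (ℤ._≤ + n) (sym +∣d-m∣≡d-m) (offset-≤ m d (+ n) d≤m+n))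
  t : Fin (suc n)
  t = Fin.fromℕ< (ℕ.s≤s ∣d-m∣≤n)
  m+t≡d : m ℤ.+ fz t ≡ d
  m+t≡d = begin
      m ℤ.+ + toℕ t          ≡⟨ cong (λ k → m ℤ.+ + k) (toℕ-fromℕ< (ℕ.s≤s ∣d-m∣≤n)) ⟩
      m ℤ.+ + ∣ d ℤ.- m ∣    ≡⟨ cong (λ x → m ℤ.+ x) +∣d-m∣≡d-m ⟩
      m ℤ.+ (d ℤ.- m)        ≡⟨ m+[d-m]≡d m d ⟩
      d                      ∎
    where
    open ≡-Reasoning
    m+[d-m]≡d : ∀ m d → m ℤ.+ (d ℤ.- m) ≡ d
    m+[d-m]≡d = solve-∀

altSum-cong : ∀ m {f g : Fin m → ℚ} → (∀ x → f x ≡ g x) → altSum m f ≡ altSum m g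
altSum-cong zero    _   = refl
altSum-cong (suc m) f≡g = cong₂ ℚ._-_ (f≡g zero) (altSum-cong m (λ x → f≡g (suc x)))

det-cong : ∀ m {M N : Fin m → Fin m → ℚ} → (∀ r s → M r s ≡ N r s) → det m M ≡ det m N
det-cong zero    _   = refl
det-cong (suc m) M≡N = altSum-cong (suc m) λ c →
  cong₂ ℚ._*_ (M≡N zero c) (det-cong m λ r s → M≡N (suc r) (Fin.punchIn c s))

rotate : Fin 4 → Fin 4
rotate 0F = 1F
rotate 1F = 2F
rotate 2F = 3F
rotate 3F = 0F

rotate⁻¹ : Fin 4 → Fin 4
rotate⁻¹ 0F = 3F
rotate⁻¹ 1F = 0F
rotate⁻¹ 2F = 1F
rotate⁻¹ 3F = 2F

rotate∘rotate⁻¹ : ∀ c → rotate (rotate⁻¹ c) ≡ c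
rotate∘rotate⁻¹ 0F = refl
rotate∘rotate⁻¹ 1F = refl
rotate∘rotate⁻¹ 2F = refl
rotate∘rotate⁻¹ 3F = refl

_⊕_ : Fin 4 → ℕ → Fin 4
c ⊕ zero  = c
c ⊕ suc r = rotate (c ⊕ r)

_⊖_ : Fin 4 → ℕ → Fin 4
c ⊖ zero  = c
c ⊖ suc r = rotate⁻¹ (c ⊖ r)

class : ℤ → Fin 4
class (+ n)    = 0F ⊕ n
class -[1+ n ] = 3F ⊖ n

class-suc : ∀ i → class (i ℤ.+ + 1) ≡ rotate (class i)
class-suc (+ n) rewrite ℕ.+-comm n 1 = refl
class-suc -[1+ zero ]  = refl
class-suc -[1+ suc n ] = sym (rotate∘rotate⁻¹ (3F ⊖ n))

class-+ : ∀ i r → class (i ℤ.+ + r) ≡ class i ⊕ r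
class-+ i zero    = cong class (ℤ.+-identityʳ i)
class-+ i (suc r) = begin
    class (i ℤ.+ + suc r)           ≡⟨ cong (λ k → class (i ℤ.+ + k)) (ℕ.+-comm 1 r) ⟩
    class (i ℤ.+ (+ r ℤ.+ + 1))     ≡⟨ cong class (sym (ℤ.+-assoc i (+ r) (+ 1))) ⟩
    class ((i ℤ.+ + r) ℤ.+ + 1)     ≡⟨ class-suc (i ℤ.+ + r) ⟩
    rotate (class (i ℤ.+ + r))      ≡⟨ cong rotate (class-+ i r) ⟩
    rotate (class i ⊕ r)            ∎
  where open ≡-Reasoning

rowEntries : Fin 4 → Bool → Vec ℕ 5
rowEntries 0F _ = 1 ∷ 1 ∷ 1 ∷ 1 ∷ 1 ∷ []
rowEntries 1F f = 1 ∷ 1 ∷ 2 ∷ 1 ∷ (if f then 2 else 1) ∷ []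
rowEntries 2F _ = 1 ∷ 2 ∷ 2 ∷ 1 ∷ 1 ∷ []
rowEntries 3F _ = 2 ∷ 2 ∷ 2 ∷ 1 ∷ 1 ∷ []

rowEntries-cong-flag : ∀ c {f f′} → (c ≡ 1F → f ≡ f′) → rowEntries c f ≡ rowEntries c f′
rowEntries-cong-flag 0F _ = refl
rowEntries-cong-flag 1F f≡f′ = cong (rowEntries 1F) (f≡f′ refl)
rowEntries-cong-flag 2F _ = refl
rowEntries-cong-flag 3F _ = refl

-- rowAt cs d is a_{i,i+d} for a row with entries cs.  The clauses for d ≥ 5 precede the
-- others so that rowAt reduces on such d without inspecting cs.
rowAt : Vec ℕ 5 → ℤ → ℕ
rowAt _                       -[1+ 0 ]     = 1
rowAt _                       -[1+ suc _ ] = 0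
rowAt _                       (+ 5)        = 1
rowAt _                       (+ suc (suc (suc (suc (suc (suc _)))))) = 0
rowAt (x ∷ _)                 (+ 0)        = x
rowAt (_ ∷ x ∷ _)             (+ 1)        = x
rowAt (_ ∷ _ ∷ x ∷ _)         (+ 2)        = x
rowAt (_ ∷ _ ∷ _ ∷ x ∷ _)     (+ 3)        = x
rowAt (_ ∷ _ ∷ _ ∷ _ ∷ x ∷ _) (+ 4)        = x

rowAt-below : ∀ cs d → d ℤ.≤ -[1+ 1 ] → rowAt cs d ≡ 0
rowAt-below cs _ (ℤ.-≤- (ℕ.s≤s _)) = refl

rowAt-above : ∀ cs d → + 6 ℤ.≤ d → rowAt cs d ≡ 0
rowAt-above cs _ (ℤ.+≤+ (ℕ.s≤s (ℕ.s≤s (ℕ.s≤s (ℕ.s≤s (ℕ.s≤s (ℕ.s≤s _))))))) = refl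

rowValue : Fin 4 → Bool → ℤ → ℚ
rowValue c f d = + rowAt (rowEntries c f) d ℚ./ 1

frieze : (ℤ → Bool) → ℤ → ℤ → ℚ
frieze flags i j = rowValue (class i) (flags i) (j ℤ.- i)

entry-frieze : ∀ flags i j → entry (frieze flags) i j ≡ rowValue (class i) (flags i) (j ℤ.- + 1)
entry-frieze flags i j = cong (rowValue (class i) (flags i)) (i+j-1-i≡j-1 i j)
  where
  i+j-1-i≡j-1 : ∀ i j → (i ℤ.+ j ℤ.- + 1) ℤ.- i ≡ j ℤ.- + 1
  i+j-1-i≡j-1 = solve-∀

window : Fin 4 → Bool → ℤ → Fin 4 → Fin 4 → ℚ
window c f d r s = rowValue (c ⊕ toℕ r) f (d ℤ.+ fz s ℤ.- fz r)

windowDet≡1? : ∀ f → Dec (∀ c (t : Fin 7) → det 4 (window c f (-[1+ 0 ] ℤ.+ fz t)) ≡ ℚ.1ℚ)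
windowDet≡1? f = all? λ (c : Fin 4) → all? λ (t : Fin 7) →
  det 4 (window c f (-[1+ 0 ] ℤ.+ fz t)) ℚ.≟ ℚ.1ℚ

windowDet≡1 : ∀ f c (t : Fin 7) → det 4 (window c f (-[1+ 0 ] ℤ.+ fz t)) ≡ ℚ.1ℚ
windowDet≡1 false = from-yes (windowDet≡1? false)
windowDet≡1 true  = from-yes (windowDet≡1? true)

offsetTo1F : Fin 4 → ℕ
offsetTo1F 0F = 1
offsetTo1F 1F = 0
offsetTo1F 2F = 3
offsetTo1F 3F = 2

⊕≡1F⇒offsetTo1F : ∀ c (r : Fin 4) → c ⊕ toℕ r ≡ 1F → toℕ r ≡ offsetTo1F c
⊕≡1F⇒offsetTo1F = from-yes (all? λ (c : Fin 4) → all? λ (r : Fin 4) →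
  (c ⊕ toℕ r Fin.≟ 1F) →-dec (toℕ r ℕ.≟ offsetTo1F c))

-- A window meets exactly one row of class 1F, and only that row reads its flag.
frieze-window : ∀ flags i j (r s : Fin 4) →
  frieze flags (i ℤ.+ fz r) (j ℤ.+ fz s) ≡
  window (class i) (flags (i ℤ.+ + offsetTo1F (class i))) (j ℤ.- i) r s
frieze-window flags i j r s = begin
    rowValue (class (i ℤ.+ fz r)) (flags (i ℤ.+ fz r)) ((j ℤ.+ fz s) ℤ.- (i ℤ.+ fz r))
  ≡⟨ cong (rowValue _ _) (shift i j (fz r) (fz s)) ⟩
    rowValue (class (i ℤ.+ fz r)) (flags (i ℤ.+ fz r)) d
  ≡⟨ cong (λ c → rowValue c (flags (i ℤ.+ fz r)) d) (class-+ i (toℕ r)) ⟩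
    rowValue (class i ⊕ toℕ r) (flags (i ℤ.+ fz r)) d
  ≡⟨ cong (λ cs → + rowAt cs d ℚ./ 1) (rowEntries-cong-flag (class i ⊕ toℕ r) λ hit →
       cong (λ k → flags (i ℤ.+ + k)) (⊕≡1F⇒offsetTo1F (class i) r hit)) ⟩
    rowValue (class i ⊕ toℕ r) (flags (i ℤ.+ + offsetTo1F (class i))) d
  ∎
  where
  open ≡-Reasoning
  d : ℤ
  d = j ℤ.- i ℤ.+ fz s ℤ.- fz r
  shift : ∀ i j x y → (j ℤ.+ y) ℤ.- (i ℤ.+ x) ≡ j ℤ.- i ℤ.+ y ℤ.- x
  shift = solve-∀

frieze-isSLFrieze : ∀ flags → IsSLFrieze 4 5 (frieze flags)
frieze-isSLFrieze flags = below , above , left , right , unimodular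
  where
  ofℕ : ℕ → ℚ
  ofℕ n = + n ℚ./ 1

  below : ∀ i j → i ℤ.- + 4 ℤ.≤ j → j ℤ.≤ i ℤ.- + 2 → frieze flags i j ≡ ℚ.0ℚ
  below i j _ j≤i-2 = cong ofℕ (rowAt-below _ (j ℤ.- i) (offset-≤ i j -[1+ 1 ] j≤i-2))

  above : ∀ i j → i ℤ.+ + 5 ℤ.+ + 1 ℤ.≤ j → j ℤ.≤ i ℤ.+ + 5 ℤ.+ + 4 ℤ.- + 1 →
          frieze flags i j ≡ ℚ.0ℚ
  above i j i+6≤j _ = cong ofℕ (rowAt-above _ (j ℤ.- i)
    (offset-≥ i j (+ 6) (subst (ℤ._≤ j) (ℤ.+-assoc i (+ 5) (+ 1)) i+6≤j)))

  left : ∀ i → frieze flags i (i ℤ.- + 1) ≡ ℚ.1ℚ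
  left i = cong ofℕ (cong (rowAt _) (i+c-i≡c i -[1+ 0 ]))

  right : ∀ i → frieze flags i (i ℤ.+ + 5) ≡ ℚ.1ℚ
  right i = cong ofℕ (cong (rowAt _) (i+c-i≡c i (+ 5)))

  unimodular : ∀ i j → i ℤ.- + 1 ℤ.≤ j → j ℤ.≤ i ℤ.+ + 5 →
               det 4 (λ r s → frieze flags (i ℤ.+ fz r) (j ℤ.+ fz s)) ≡ ℚ.1ℚ
  unimodular i j i-1≤j j≤i+5 = trans (det-cong 4 (frieze-window flags i j))
    (∀-interval (λ d → det 4 (window c f d) ≡ ℚ.1ℚ) -[1+ 0 ] 6 (windowDet≡1 f c)
       (j ℤ.- i) (offset-≥ i j -[1+ 0 ] i-1≤j) (offset-≤ i j (+ 5) j≤i+5))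
    where
    c : Fin 4
    c = class i
    f : Bool
    f = flags (i ℤ.+ + offsetTo1F c)

rowEntries-positive? : ∀ f → Dec (∀ c (t : Fin 5) → 0 ℕ.< rowAt (rowEntries c f) (+ 0 ℤ.+ fz t))
rowEntries-positive? f = all? λ (c : Fin 4) → all? λ (t : Fin 5) →
  0 ℕ.<? rowAt (rowEntries c f) (+ 0 ℤ.+ fz t)

rowEntries-positive : ∀ f c (t : Fin 5) → 0 ℕ.< rowAt (rowEntries c f) (+ 0 ℤ.+ fz t)
rowEntries-positive false = from-yes (rowEntries-positive? false)
rowEntries-positive true  = from-yes (rowEntries-positive? true)

frieze-entries-positive : ∀ flags i j → + 1 ℤ.≤ j → j ℤ.≤ + 5 → IsPosInt (entry (frieze flags) i j)
frieze-entries-positive flags i j 1≤j j≤5 rewrite entry-frieze flags i j =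
  rowAt cs (j ℤ.- + 1) , positive , refl
  where
  cs : Vec ℕ 5
  cs = rowEntries (class i) (flags i)
  positive : 0 ℕ.< rowAt cs (j ℤ.- + 1)
  positive = ∀-interval (λ d → 0 ℕ.< rowAt cs d) (+ 0) 4 (rowEntries-positive (flags i) (class i))
    (j ℤ.- + 1) (offset-≥ (+ 1) j (+ 0) 1≤j) (offset-≤ (+ 1) j (+ 4) j≤5)

lastEntry-unflagged : ∀ c → rowValue c false (+ 4) ≡ ℚ.1ℚ
lastEntry-unflagged 0F = refl
lastEntry-unflagged 1F = refl
lastEntry-unflagged 2F = refl
lastEntry-unflagged 3F = refl

frieze-aperiodic : ∀ flags i₀ → class i₀ ≡ 1F → flags i₀ ≡ true →
  (∀ m → flags (i₀ ℤ.+ + suc m) ≡ false) → ¬ IsPeriodic 5 (frieze flags)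
frieze-aperiodic flags i₀ class≡1F flagged unflagged (suc m , _ , periodic) = 2≢1 (begin
    + 2 ℚ./ 1                             ≡⟨ cong₂ (λ c f → rowValue c f (+ 4)) class≡1F flagged ⟨
    rowValue (class i₀) (flags i₀) (+ 4)  ≡⟨ entry-frieze flags i₀ (+ 5) ⟨
    entry (frieze flags) i₀ (+ 5)         ≡⟨ periodic i₀ (+ 5) (ℤ.+≤+ (ℕ.s≤s ℕ.z≤n)) ℤ.≤-refl ⟩
    entry (frieze flags) i (+ 5)          ≡⟨ entry-frieze flags i (+ 5) ⟩
    rowValue (class i) (flags i) (+ 4)    ≡⟨ cong (λ f → rowValue (class i) f (+ 4)) (unflagged m) ⟩
    rowValue (class i) false (+ 4)        ≡⟨ lastEntry-unflagged (class i) ⟩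
    ℚ.1ℚ                                  ∎)
  where
  open ≡-Reasoning
  i : ℤ
  i = i₀ ℤ.+ + suc m
  2≢1 : ¬ (+ 2 ℚ./ 1 ≡ ℚ.1ℚ)
  2≢1 ()

isOne : ℤ → Bool
isOne i = does (i ℤ.≟ + 1)

mainTheorem2 : Σ ℕ λ k → 2 ℕ.≤ k × Σ ℕ λ n → 1 ℕ.≤ n ×
    Σ (ℤ → ℤ → ℚ) λ a → IsSLFrieze k n a × ¬ IsPeriodic n a ×
      (∀ (i j : ℤ) → + 1 ℤ.≤ j → j ℤ.≤ + n → IsPosInt (entry a i j))
mainTheorem2 =
  4 , ℕ.s≤s (ℕ.s≤s ℕ.z≤n) , 5 , ℕ.s≤s ℕ.z≤n , frieze isOne ,
  frieze-isSLFrieze isOne ,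
  frieze-aperiodic isOne (+ 1) refl refl (λ _ → refl) ,
  frieze-entries-positive isOne
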